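{- For every integer $d\ge 2$, $$E_{\mathrm{St}_d^\ast}(n) = (2n+1)\,E_{\mathrm{St}_{d-1}^\ast}(n) - \tfrac{1}{2}\,n(n+1)\,E_{\mathrm{St}_{d-2}^\ast}(n).$$
   Context: For $d\ge 1$, $\mathrm{St}_d^\ast = \{(x_1,\ldots,x_d)\in\mathbb{R}^d \mid -1\le x_i\le 1\ (1\le i\le d),\ x_j+\cdots+x_k\le 1\ (1\le j<k\le d)\}$ (so $\mathrm{St}_1^\ast=[-1,1]$), and by convention $E_{\mathrm{St}_0^\ast}(n)=1$. For a lattice polytope $P\subset\mathbb{R}^d$, $E_P(n)$ denotes its Ehrhart polynomial, i.e. $E_P(n)=|nP\cap\mathbb{Z}^d|$ for integers $n>0$. -}

module Defs where

open import Data.Bool using (Bool; true; false; _∧_; if_then_else_)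
open import Data.Nat as ℕ using (ℕ; zero; suc)
open import Data.Integer as ℤ using (ℤ; +_; -_; _+_; _≤ᵇ_)
open import Data.List as List using (List; []; _∷_; map; concatMap; filter; length)
open import Data.Vec using (Vec; []; _∷_)
open import Data.Bool.Properties using (T?)

intRange : ℕ → List ℤ
intRange n = List.map (λ i → ℤ.- (+ n) ℤ.+ (+ i)) (List.upTo (suc (2 ℕ.* n)))

box : ℕ → (d : ℕ) → List (Vec ℤ d)
box n zero    = [] ∷ []
box n (suc d) = concatMap (λ x → map (x ∷_) (box n d)) (intRange n)

-- For a running sum s = x_j + ... + x_{k-1} and the remaining entries
-- x_k, x_{k+1}, ..., check that every sum x_j + ... + x_k (k > j) is ≤ n.
prefixSumsOK : ℕ → ℤ → {d : ℕ} → Vec ℤ d → Bool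
prefixSumsOK n s []       = true
prefixSumsOK n s (y ∷ ys) = ((s + y) ≤ᵇ + n) ∧ prefixSumsOK n (s + y) ys

consecSumsOK : ℕ → {d : ℕ} → Vec ℤ d → Bool
consecSumsOK n []       = true
consecSumsOK n (x ∷ xs) = prefixSumsOK n x xs ∧ consecSumsOK n xs

boxOK : ℕ → {d : ℕ} → Vec ℤ d → Bool
boxOK n []       = true
boxOK n (x ∷ xs) = (ℤ.- (+ n) ≤ᵇ x) ∧ (x ≤ᵇ + n) ∧ boxOK n xs

inDilatedSt : ℕ → {d : ℕ} → Vec ℤ d → Bool
inDilatedSt n x = boxOK n x ∧ consecSumsOK n x

-- E_{St_d^*}(n) = | n St_d^* ∩ ℤ^d |  (for d = 0 this is 1, matching the convention).
EhrhartSt : (d : ℕ) → ℕ → ℕ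
EhrhartSt d n = length (filter (λ x → T? (inDilatedSt n x)) (box n d))

{-# OPTIONS --safe #-}
-- Write a point of n·St*_{d+1} as x ∷ xs. Its consecutive-sum constraints that involve x
-- say exactly x + u ≤ n, where u ≥ 0 is the largest prefix sum of xs (the empty prefix
-- included), and u ≤ n whenever xs lies in n·St*_d. Summing over x ∈ [-n, n] therefore gives
-- E_{d+1} = Σ (2n + 1 - u) over xs ∈ n·St*_d, that is E_{d+1} + S_d = (2n + 1) E_d with
-- S_d = Σ u. The largest prefix sum of x ∷ xs is max (0, x + u), and as x runs over
-- [-n, n - u] this runs through 0, …, 0, 1, …, n, so 2 S_{d+1} = n (n + 1) E_d.
-- Eliminating S_{d+1} gives the recurrence.
module Submission where

open import Defs
open import Data.Bool using (Bool; true; false; _∧_; T)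
open import Data.List using (List; []; _∷_; _++_; map; concatMap; filter; length; upTo; applyUpTo)
open import Data.Nat using (ℕ; zero; suc)
import Data.Nat as ℕ
open import Data.Nat.ListAction using (sum)
open import Data.Vec using (Vec; []; _∷_)
open import Function using (_∘_; Equivalence)
open import Relation.Binary.PropositionalEquality
  using (_≡_; _≗_; refl; sym; trans; cong; cong₂; subst; module ≡-Reasoning)
open ≡-Reasoning

module Sums where
  open import Data.Nat using (_+_; _*_; _∸_; _≤_; _<_; _≤ᵇ_; z≤n; s≤s)
  open import Data.Nat.Properties
  open import Data.Nat.ListAction.Properties using (sum-++)
  open import Data.Nat.Tactic.RingSolver using (solve-∀)
  open import Algebra.Properties.CommutativeSemigroup +-commutativeSemigroup using (interchange)
  open import Data.Bool.Properties using (T?)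
  open import Data.List.Properties using (map-++; map-cong)
  open import Relation.Nullary using (contradiction)

  private variable
    A B : Set

  𝟙 : Bool → ℕ
  𝟙 true  = 1
  𝟙 false = 0

  𝟙-∧ : ∀ a b → 𝟙 (a ∧ b) ≡ 𝟙 a * 𝟙 b
  𝟙-∧ true  b = sym (+-identityʳ (𝟙 b))
  𝟙-∧ false b = refl

  𝟙-≤ᵇ : ∀ {m n} → m ≤ n → 𝟙 (m ≤ᵇ n) ≡ 1
  𝟙-≤ᵇ {m} {n} m≤n with m ≤ᵇ n | ≤⇒≤ᵇ m≤n
  ... | true  | _  = refl
  ... | false | ()

  𝟙-≰ᵇ : ∀ {m n} → n < m → 𝟙 (m ≤ᵇ n) ≡ 0
  𝟙-≰ᵇ {m} {n} n<m with m ≤ᵇ n | ≤ᵇ⇒≤ m n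
  ... | true  | m≤n = contradiction (m≤n _) (<⇒≱ n<m)
  ... | false | _   = refl

  length-filter-T? : (p : A → Bool) (xs : List A) →
                     length (filter (T? ∘ p) xs) ≡ sum (map (𝟙 ∘ p) xs)
  length-filter-T? p []       = refl
  length-filter-T? p (x ∷ xs) with p x
  ... | true  = cong suc (length-filter-T? p xs)
  ... | false = length-filter-T? p xs

  sum-map-cong : {f g : A → ℕ} → f ≗ g → (xs : List A) → sum (map f xs) ≡ sum (map g xs)
  sum-map-cong f≗g xs = cong sum (map-cong f≗g xs)

  sum-map-++ : (f : A → ℕ) (xs ys : List A) →
               sum (map f (xs ++ ys)) ≡ sum (map f xs) + sum (map f ys)
  sum-map-++ f xs ys = trans (cong sum (map-++ f xs ys)) (sum-++ (map f xs) (map f ys))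

  sum-map-concatMap : (f : B → ℕ) (g : A → List B) (xs : List A) →
                      sum (map f (concatMap g xs)) ≡ sum (map (λ x → sum (map f (g x))) xs)
  sum-map-concatMap f g []       = refl
  sum-map-concatMap f g (x ∷ xs) =
    trans (sum-map-++ f (g x) (concatMap g xs)) (cong (sum (map f (g x)) +_) (sum-map-concatMap f g xs))

  sum-map-zero : (xs : List A) → sum (map (λ _ → 0) xs) ≡ 0
  sum-map-zero []       = refl
  sum-map-zero (x ∷ xs) = sum-map-zero xs

  sum-map-+ : (f g : A → ℕ) (xs : List A) →
              sum (map (λ x → f x + g x) xs) ≡ sum (map f xs) + sum (map g xs)
  sum-map-+ f g []       = refl
  sum-map-+ f g (x ∷ xs) =
    trans (cong (f x + g x +_) (sum-map-+ f g xs)) (interchange (f x) (g x) _ _)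

  sum-map-*ˡ : (c : ℕ) (f : A → ℕ) (xs : List A) →
               sum (map (λ x → c * f x) xs) ≡ c * sum (map f xs)
  sum-map-*ˡ c f []       = sym (*-zeroʳ c)
  sum-map-*ˡ c f (x ∷ xs) = trans (cong (c * f x +_) (sum-map-*ˡ c f xs)) (sym (*-distribˡ-+ c (f x) _))

  sum-map-swap : (f : A → B → ℕ) (xs : List A) (ys : List B) →
                 sum (map (λ x → sum (map (f x) ys)) xs)
                   ≡ sum (map (λ y → sum (map (λ x → f x y) xs)) ys)
  sum-map-swap f []       ys = sym (sum-map-zero ys)
  sum-map-swap f (x ∷ xs) ys =
    trans (cong (sum (map (f x) ys) +_) (sum-map-swap f xs ys)) (sym (sum-map-+ (f x) _ ys))

  ∑< : ℕ → (ℕ → ℕ) → ℕ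
  ∑< zero    f = 0
  ∑< (suc k) f = f 0 + ∑< k (f ∘ suc)

  syntax ∑< k (λ i → e) = ∑[ i < k ] e

  sum-map-applyUpTo : (f : A → ℕ) (g : ℕ → A) (k : ℕ) →
                      sum (map f (applyUpTo g k)) ≡ ∑[ i < k ] f (g i)
  sum-map-applyUpTo f g zero    = refl
  sum-map-applyUpTo f g (suc k) = cong (f (g 0) +_) (sum-map-applyUpTo f (g ∘ suc) k)

  ∑<-cong : ∀ k {f g : ℕ → ℕ} → (∀ {i} → i < k → f i ≡ g i) → ∑< k f ≡ ∑< k g
  ∑<-cong zero    f≡g = refl
  ∑<-cong (suc k) f≡g = cong₂ _+_ (f≡g (s≤s z≤n)) (∑<-cong k (f≡g ∘ s≤s))

  ∑<-zeros : ∀ k {f : ℕ → ℕ} → (∀ {i} → i < k → f i ≡ 0) → ∑< k f ≡ 0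
  ∑<-zeros zero    f≡0 = refl
  ∑<-zeros (suc k) f≡0 = cong₂ _+_ (f≡0 (s≤s z≤n)) (∑<-zeros k (f≡0 ∘ s≤s))

  ∑<-ones : ∀ k {f : ℕ → ℕ} → (∀ {i} → i < k → f i ≡ 1) → ∑< k f ≡ k
  ∑<-ones zero    f≡1 = refl
  ∑<-ones (suc k) f≡1 = cong₂ _+_ (f≡1 (s≤s z≤n)) (∑<-ones k (f≡1 ∘ s≤s))

  ∑<-+ : ∀ a b (f : ℕ → ℕ) → ∑< (a + b) f ≡ ∑< a f + ∑[ i < b ] f (a + i)
  ∑<-+ zero    b f = refl
  ∑<-+ (suc a) b f = trans (cong (f 0 +_) (∑<-+ a b (f ∘ suc))) (sym (+-assoc (f 0) _ _))

  ∑<-shift : ∀ a b (f : ℕ → ℕ) → ∑< a f + ∑[ i < b ] f (a + i) ≡ ∑< b f + ∑[ i < a ] f (b + i)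
  ∑<-shift a b f = begin
    ∑< a f + ∑[ i < b ] f (a + i)  ≡⟨ ∑<-+ a b f ⟨
    ∑< (a + b) f                    ≡⟨ cong (λ k → ∑< k f) (+-comm a b) ⟩
    ∑< (b + a) f                    ≡⟨ ∑<-+ b a f ⟩
    ∑< b f + ∑[ i < a ] f (b + i)  ∎

  ∑<-suc : ∀ k (f : ℕ → ℕ) → ∑< (suc k) f ≡ ∑< k f + f k
  ∑<-suc zero    f = +-comm (f 0) 0
  ∑<-suc (suc k) f = trans (cong (f 0 +_) (∑<-suc k (f ∘ suc))) (sym (+-assoc (f 0) _ _))

  ∑<-triangular : ∀ k → 2 * ∑[ i < k ] suc i ≡ k * suc k
  ∑<-triangular zero    = refl
  ∑<-triangular (suc k) = begin
    2 * ∑[ i < suc k ] suc i          ≡⟨ cong (2 *_) (∑<-suc k suc) ⟩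
    2 * (∑[ i < k ] suc i + suc k)    ≡⟨ *-distribˡ-+ 2 (∑[ i < k ] suc i) (suc k) ⟩
    2 * ∑[ i < k ] suc i + 2 * suc k  ≡⟨ cong (_+ 2 * suc k) (∑<-triangular k) ⟩
    k * suc k + 2 * suc k             ≡⟨ step k ⟩
    suc k * suc (suc k)               ∎
    where
    step : ∀ k → k * suc k + 2 * suc k ≡ suc k * suc (suc k)
    step = solve-∀

  ∑<-window-𝟙 : ∀ c u → u ≤ suc c → ∑[ i < suc c ] 𝟙 (u + i ≤ᵇ c) + u ≡ suc c
  ∑<-window-𝟙 c u u≤1+c = begin
    X + u                          ≡⟨ +-comm X u ⟩
    u + X                          ≡⟨ cong (_+ X) (∑<-ones u (λ i<u → f-in (<-≤-trans i<u u≤1+c))) ⟨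
    ∑< u f + X                     ≡⟨ ∑<-shift u K f ⟩
    ∑< K f + ∑[ i < u ] f (K + i)  ≡⟨ cong₂ _+_ (∑<-ones K f-in) (∑<-zeros u (λ {i} _ → f-out i)) ⟩
    K + 0                          ≡⟨ +-identityʳ K ⟩
    K                              ∎
    where
    K : ℕ
    K = suc c
    f : ℕ → ℕ
    f j = 𝟙 (j ≤ᵇ c)
    X : ℕ
    X = ∑[ i < K ] f (u + i)
    f-in : ∀ {j} → j < K → f j ≡ 1
    f-in = 𝟙-≤ᵇ ∘ ≤-pred
    f-out : ∀ i → f (K + i) ≡ 0
    f-out i = 𝟙-≰ᵇ (s≤s (m≤m+n c i))

  ∑<-window-∸ : ∀ n u → u ≤ n →
                2 * ∑[ i < suc (n + n) ] (𝟙 (u + i ≤ᵇ n + n) * (u + i ∸ n)) ≡ n * suc n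
  ∑<-window-∸ n u u≤n = begin
    2 * X                                          ≡⟨ cong (2 *_) window ⟩
    2 * ∑< K f                                     ≡⟨ cong (2 *_) (∑<-+ (suc n) n f) ⟩
    2 * (∑< (suc n) f + ∑[ i < n ] f (suc n + i))  ≡⟨ cong (λ s → 2 * (s + ∑[ i < n ] f (suc n + i))) low ⟩
    2 * ∑[ i < n ] f (suc n + i)                   ≡⟨ cong (2 *_) (∑<-cong n f-high) ⟩
    2 * ∑[ i < n ] suc i                           ≡⟨ ∑<-triangular n ⟩
    n * suc n                                      ∎
    where
    K : ℕ
    K = suc (n + n)
    f : ℕ → ℕ
    f j = 𝟙 (j ≤ᵇ n + n) * (j ∸ n)
    X : ℕ
    X = ∑[ i < K ] f (u + i)
    f-low : ∀ {j} → j ≤ n → f j ≡ 0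
    f-low {j} j≤n = trans (cong (𝟙 (j ≤ᵇ n + n) *_) (m≤n⇒m∸n≡0 j≤n)) (*-zeroʳ (𝟙 (j ≤ᵇ n + n)))
    f-high : ∀ {i} → i < n → f (suc n + i) ≡ suc i
    f-high {i} i<n = begin
      𝟙 (suc n + i ≤ᵇ n + n) * (suc n + i ∸ n)
        ≡⟨ cong₂ _*_ (𝟙-≤ᵇ (+-monoʳ-< n i<n)) (trans (cong (_∸ n) (sym (+-suc n i))) (m+n∸m≡n n (suc i))) ⟩
      1 * suc i
        ≡⟨ *-identityˡ (suc i) ⟩
      suc i
        ∎
    f-out : ∀ i → f (K + i) ≡ 0
    f-out i = cong (_* (K + i ∸ n)) (𝟙-≰ᵇ (s≤s (m≤m+n (n + n) i)))
    low : ∑< (suc n) f ≡ 0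
    low = ∑<-zeros (suc n) (f-low ∘ ≤-pred)
    -- Shifting the window by u ≤ n only trades terms that vanish (f is 0 up to n and beyond n + n).
    window : X ≡ ∑< K f
    window = begin
      X                              ≡⟨ cong (_+ X) (∑<-zeros u (λ i<u → f-low (≤-trans (<⇒≤ i<u) u≤n))) ⟨
      ∑< u f + X                     ≡⟨ ∑<-shift u K f ⟩
      ∑< K f + ∑[ i < u ] f (K + i)  ≡⟨ cong (∑< K f +_) (∑<-zeros u (λ {i} _ → f-out i)) ⟩
      ∑< K f + 0                     ≡⟨ +-identityʳ (∑< K f) ⟩
      ∑< K f                         ∎

module PrefixSums where
  import Data.Nat.Properties as ℕ
  open import Data.Integer using (ℤ; +_; -_; -[1+_]; -≤+; _+_; _≤_; _≤ᵇ_; _⊖_)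
  open import Data.Integer.Properties
  open import Data.Bool.Properties using (∧-assoc; ∧-identityʳ; ∧-commutativeMonoid; T-≡; T-∧)
  open import Algebra.Bundles using (CommutativeMonoid)
  open import Algebra.Properties.CommutativeSemigroup (CommutativeMonoid.commutativeSemigroup ∧-commutativeMonoid)
    using (interchange)
  open import Data.Empty using (⊥-elim)
  open import Data.Product using (proj₁; proj₂)

  posPart : ℤ → ℕ
  posPart (+ k)    = k
  posPart -[1+ k ] = 0

  -- max (0, x₁, x₁ + x₂, …, x₁ + ⋯ + x_d)
  maxPrefixSum : ∀ {d} → Vec ℤ d → ℕ
  maxPrefixSum []       = 0
  maxPrefixSum (x ∷ xs) = posPart (x + + maxPrefixSum xs)

  headOK : ℕ → ℕ → ℤ → Bool
  headOK n u x = (- (+ n) ≤ᵇ x) ∧ (x + + u ≤ᵇ + n)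

  ∧-≡ʳ : ∀ {a b} → (T b → T a) → a ∧ b ≡ b
  ∧-≡ʳ {true}          _   = refl
  ∧-≡ʳ {false} {true}  b⇒a = ⊥-elim (b⇒a _)
  ∧-≡ʳ {false} {false} _   = refl

  ∧-≡ˡ : ∀ {a b} → (T a → T b) → a ∧ b ≡ a
  ∧-≡ˡ {true} {true}  _   = refl
  ∧-≡ˡ {true} {false} a⇒b = ⊥-elim (a⇒b _)
  ∧-≡ˡ {false}        _   = refl

  ≤ᵇ-posPart : ∀ s z c → (s ≤ᵇ c) ∧ (s + z ≤ᵇ c) ≡ (s + + posPart z ≤ᵇ c)
  ≤ᵇ-posPart s (+ k)    c = ∧-≡ʳ (λ s+k≤c → ≤⇒≤ᵇ (≤-trans (i≤i+j s (+ k)) (≤ᵇ⇒≤ s+k≤c)))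
  ≤ᵇ-posPart s -[1+ k ] c =
    trans (∧-≡ˡ (λ s≤c → ≤⇒≤ᵇ (≤-trans s+z≤s (≤ᵇ⇒≤ s≤c)))) (cong (_≤ᵇ c) (sym (+-identityʳ s)))
    where
    s+z≤s : s + -[1+ k ] ≤ s
    s+z≤s = ≤-trans (+-monoʳ-≤ s -≤+) (≤-reflexive (+-identityʳ s))

  prefixSumsOK-maxPrefixSum : ∀ n s {d} (xs : Vec ℤ d) →
                              (s ≤ᵇ + n) ∧ prefixSumsOK n s xs ≡ (s + + maxPrefixSum xs ≤ᵇ + n)
  prefixSumsOK-maxPrefixSum n s []       = trans (∧-identityʳ _) (cong (_≤ᵇ + n) (sym (+-identityʳ s)))
  prefixSumsOK-maxPrefixSum n s (y ∷ ys) = begin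
    (s ≤ᵇ + n) ∧ ((s + y ≤ᵇ + n) ∧ prefixSumsOK n (s + y) ys)
      ≡⟨ cong ((s ≤ᵇ + n) ∧_) (prefixSumsOK-maxPrefixSum n (s + y) ys) ⟩
    (s ≤ᵇ + n) ∧ (s + y + + maxPrefixSum ys ≤ᵇ + n)
      ≡⟨ cong (λ t → (s ≤ᵇ + n) ∧ (t ≤ᵇ + n)) (+-assoc s y (+ maxPrefixSum ys)) ⟩
    (s ≤ᵇ + n) ∧ (s + (y + + maxPrefixSum ys) ≤ᵇ + n)
      ≡⟨ ≤ᵇ-posPart s (y + + maxPrefixSum ys) (+ n) ⟩
    (s + + maxPrefixSum (y ∷ ys) ≤ᵇ + n)
      ∎

  inDilatedSt-∷ : ∀ n x {d} (xs : Vec ℤ d) →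
                  inDilatedSt n (x ∷ xs) ≡ headOK n (maxPrefixSum xs) x ∧ inDilatedSt n xs
  inDilatedSt-∷ n x xs = begin
    (a ∧ (b ∧ bx)) ∧ (p ∧ cs)  ≡⟨ cong (_∧ (p ∧ cs)) (∧-assoc a b bx) ⟨
    ((a ∧ b) ∧ bx) ∧ (p ∧ cs)  ≡⟨ interchange (a ∧ b) bx p cs ⟩
    ((a ∧ b) ∧ p) ∧ (bx ∧ cs)  ≡⟨ cong (_∧ (bx ∧ cs)) (∧-assoc a b p) ⟩
    (a ∧ (b ∧ p)) ∧ (bx ∧ cs)  ≡⟨ cong (λ c → (a ∧ c) ∧ (bx ∧ cs)) (prefixSumsOK-maxPrefixSum n x xs) ⟩
    headOK n (maxPrefixSum xs) x ∧ inDilatedSt n xs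
      ∎
    where
    a b bx p cs : Bool
    a  = - (+ n) ≤ᵇ x
    b  = x ≤ᵇ + n
    bx = boxOK n xs
    p  = prefixSumsOK n x xs
    cs = consecSumsOK n xs

  posPart-≤ : ∀ {z n} → T (z ≤ᵇ + n) → posPart z ℕ.≤ n
  posPart-≤ {+ k}      {n} k≤n = ℕ.≤ᵇ⇒≤ k n k≤n
  posPart-≤ { -[1+ k ]}    _   = ℕ.z≤n

  maxPrefixSum-≤ : ∀ n {d} (xs : Vec ℤ d) → T (inDilatedSt n xs) → maxPrefixSum xs ℕ.≤ n
  maxPrefixSum-≤ n []       _     = ℕ.z≤n
  maxPrefixSum-≤ n (x ∷ xs) valid = posPart-≤ {x + + maxPrefixSum xs} x+u≤n
    where
    x-fits : T (headOK n (maxPrefixSum xs) x)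
    x-fits = proj₁ (Equivalence.to T-∧ (subst T (inDilatedSt-∷ n x xs) valid))
    x+u≤n : T (x + + maxPrefixSum xs ≤ᵇ + n)
    x+u≤n = proj₂ (Equivalence.to T-∧ x-fits)

  ⊖-≤ᵇ : ∀ j n c → (j ⊖ n ≤ᵇ + c) ≡ (j ℕ.≤ᵇ n ℕ.+ c)
  ⊖-≤ᵇ j       zero    c = refl
  ⊖-≤ᵇ zero    (suc n) c = refl
  ⊖-≤ᵇ (suc j) (suc n) c =
    trans (cong (_≤ᵇ + c) ([1+m]⊖[1+n]≡m⊖n j n)) (trans (⊖-≤ᵇ j n c) (≤ᵇ-suc j))
    where
    ≤ᵇ-suc : ∀ j {k} → (j ℕ.≤ᵇ k) ≡ (suc j ℕ.≤ᵇ suc k)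
    ≤ᵇ-suc zero    = refl
    ≤ᵇ-suc (suc j) = refl

  posPart-⊖ : ∀ j n → posPart (j ⊖ n) ≡ j ℕ.∸ n
  posPart-⊖ j       zero    = refl
  posPart-⊖ zero    (suc n) = refl
  posPart-⊖ (suc j) (suc n) = trans (cong posPart ([1+m]⊖[1+n]≡m⊖n j n)) (posPart-⊖ j n)

  i⊖n+u≡u+i⊖n : ∀ i n u → i ⊖ n + + u ≡ (u ℕ.+ i) ⊖ n
  i⊖n+u≡u+i⊖n i n u = trans (distribˡ-⊖-+-pos u i n) (cong (_⊖ n) (ℕ.+-comm i u))

  posPart-⊖-+ : ∀ i n u → posPart (i ⊖ n + + u) ≡ (u ℕ.+ i) ℕ.∸ n
  posPart-⊖-+ i n u = trans (cong posPart (i⊖n+u≡u+i⊖n i n u)) (posPart-⊖ (u ℕ.+ i) n)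

  headOK-⊖ : ∀ n u i → headOK n u (i ⊖ n) ≡ (u ℕ.+ i ℕ.≤ᵇ n ℕ.+ n)
  headOK-⊖ n u i = begin
    (- (+ n) ≤ᵇ i ⊖ n) ∧ (i ⊖ n + + u ≤ᵇ + n)
      ≡⟨ cong₂ _∧_ (Equivalence.to T-≡ (≤⇒≤ᵇ -n≤i⊖n)) (cong (_≤ᵇ + n) (i⊖n+u≡u+i⊖n i n u)) ⟩
    true ∧ ((u ℕ.+ i) ⊖ n ≤ᵇ + n)
      ≡⟨ ⊖-≤ᵇ (u ℕ.+ i) n n ⟩
    (u ℕ.+ i ℕ.≤ᵇ n ℕ.+ n)
      ∎
    where
    -n≤i⊖n : - (+ n) ≤ i ⊖ n
    -n≤i⊖n = subst (- (+ n) ≤_) (-m+n≡n⊖m n i) (i≤i+j (- (+ n)) (+ i))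

module LatticeSums where
  open import Data.Nat using (_+_; _*_; _∸_; _≤_; _<_; _≤ᵇ_)
  open import Data.Nat.Properties
  open import Data.Nat.Tactic.RingSolver using (solve-∀)
  open import Algebra.Properties.CommutativeSemigroup *-commutativeSemigroup using (x∙yz≈y∙xz; xy∙z≈y∙xz)
  open import Data.Integer as ℤ using (ℤ; +_; -_; _⊖_)
  import Data.Integer.Properties as ℤ
  open import Data.List.Properties using (map-upTo; map-∘)
  open Sums
  open PrefixSums

  sum-intRange : ∀ n (f : ℤ → ℕ) → sum (map f (intRange n)) ≡ ∑[ i < suc (n + n) ] f (i ⊖ n)
  sum-intRange n f = begin
    sum (map f (map g (upTo (suc (2 * n)))))  ≡⟨ cong (sum ∘ map f) (map-upTo g (suc (2 * n))) ⟩
    sum (map f (applyUpTo g (suc (2 * n))))   ≡⟨ sum-map-applyUpTo f g (suc (2 * n)) ⟩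
    ∑[ i < suc (2 * n) ] f (g i)              ≡⟨ cong (λ k → ∑[ i < suc (n + k) ] f (g i)) (+-identityʳ n) ⟩
    ∑[ i < suc (n + n) ] f (g i)              ≡⟨ ∑<-cong (suc (n + n)) (λ {i} _ → cong f (ℤ.-m+n≡n⊖m n i)) ⟩
    ∑[ i < suc (n + n) ] f (i ⊖ n)            ∎
    where
    g : ℕ → ℤ
    g i = - (+ n) ℤ.+ + i

  fiberSum : ℕ → ℕ → (ℤ → ℕ) → ℕ
  fiberSum n u v = sum (map (λ x → 𝟙 (headOK n u x) * v x) (intRange n))

  fiberSum-⊖ : ∀ n u (v : ℤ → ℕ) →
               fiberSum n u v ≡ ∑[ i < suc (n + n) ] (𝟙 (u + i ≤ᵇ n + n) * v (i ⊖ n))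
  fiberSum-⊖ n u v = trans (sum-intRange n (λ x → 𝟙 (headOK n u x) * v x))
    (∑<-cong (suc (n + n)) (λ {i} _ → cong (λ b → 𝟙 b * v (i ⊖ n)) (headOK-⊖ n u i)))

  fiberSum-count : ∀ n {u} → u ≤ n → fiberSum n u (λ _ → 1) + u ≡ suc (n + n)
  fiberSum-count n {u} u≤n = begin
    fiberSum n u (λ _ → 1) + u
      ≡⟨ cong (_+ u) (trans (fiberSum-⊖ n u (λ _ → 1)) (∑<-cong (suc (n + n)) drop-*1)) ⟩
    ∑[ i < suc (n + n) ] 𝟙 (u + i ≤ᵇ n + n) + u
      ≡⟨ ∑<-window-𝟙 (n + n) u (≤-trans u≤n (≤-trans (m≤m+n n n) (n≤1+n (n + n)))) ⟩
    suc (n + n)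
      ∎
    where
    drop-*1 : ∀ {i} → i < suc (n + n) → 𝟙 (u + i ≤ᵇ n + n) * 1 ≡ 𝟙 (u + i ≤ᵇ n + n)
    drop-*1 {i} _ = *-identityʳ (𝟙 (u + i ≤ᵇ n + n))

  fiberSum-posPart : ∀ n {u} → u ≤ n → 2 * fiberSum n u (λ x → posPart (x ℤ.+ + u)) ≡ n * suc n
  fiberSum-posPart n {u} u≤n = begin
    2 * fiberSum n u (λ x → posPart (x ℤ.+ + u))
      ≡⟨ cong (2 *_) (trans (fiberSum-⊖ n u (λ x → posPart (x ℤ.+ + u))) (∑<-cong (suc (n + n)) ∸-form)) ⟩
    2 * ∑[ i < suc (n + n) ] (𝟙 (u + i ≤ᵇ n + n) * (u + i ∸ n))
      ≡⟨ ∑<-window-∸ n u u≤n ⟩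
    n * suc n
      ∎
    where
    ∸-form : ∀ {i} → i < suc (n + n) →
             𝟙 (u + i ≤ᵇ n + n) * posPart (i ⊖ n ℤ.+ + u) ≡ 𝟙 (u + i ≤ᵇ n + n) * (u + i ∸ n)
    ∸-form {i} _ = cong (𝟙 (u + i ≤ᵇ n + n) *_) (posPart-⊖-+ i n u)

  latticeSum : ℕ → (d : ℕ) → (Vec ℤ d → ℕ) → ℕ
  latticeSum n d w = sum (map (λ xs → 𝟙 (inDilatedSt n xs) * w xs) (box n d))

  EhrhartSt≡latticeSum : ∀ d n → EhrhartSt d n ≡ latticeSum n d (λ _ → 1)
  EhrhartSt≡latticeSum d n = trans (length-filter-T? (inDilatedSt n) (box n d))
    (sum-map-cong (λ xs → sym (*-identityʳ (𝟙 (inDilatedSt n xs)))) (box n d))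

  latticeSum-cong : ∀ n d {w w′ : Vec ℤ d → ℕ} →
                    (∀ xs → T (inDilatedSt n xs) → w xs ≡ w′ xs) → latticeSum n d w ≡ latticeSum n d w′
  latticeSum-cong n d {w} {w′} w≡w′ = sum-map-cong pointwise (box n d)
    where
    pointwise : ∀ xs → 𝟙 (inDilatedSt n xs) * w xs ≡ 𝟙 (inDilatedSt n xs) * w′ xs
    pointwise xs with inDilatedSt n xs in valid
    ... | true  = cong (1 *_) (w≡w′ xs (subst T (sym valid) _))
    ... | false = refl

  latticeSum-+ : ∀ n d (w w′ : Vec ℤ d → ℕ) →
                 latticeSum n d (λ xs → w xs + w′ xs) ≡ latticeSum n d w + latticeSum n d w′
  latticeSum-+ n d w w′ = trans
    (sum-map-cong (λ xs → *-distribˡ-+ (𝟙 (inDilatedSt n xs)) (w xs) (w′ xs)) (box n d))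
    (sum-map-+ (λ xs → 𝟙 (inDilatedSt n xs) * w xs) (λ xs → 𝟙 (inDilatedSt n xs) * w′ xs) (box n d))

  latticeSum-*ˡ : ∀ n d c (w : Vec ℤ d → ℕ) → latticeSum n d (λ xs → c * w xs) ≡ c * latticeSum n d w
  latticeSum-*ˡ n d c w = trans
    (sum-map-cong (λ xs → x∙yz≈y∙xz (𝟙 (inDilatedSt n xs)) c (w xs)) (box n d))
    (sum-map-*ˡ c (λ xs → 𝟙 (inDilatedSt n xs) * w xs) (box n d))

  latticeSum-suc : ∀ n d (w : Vec ℤ (suc d) → ℕ) →
                   latticeSum n (suc d) w
                     ≡ latticeSum n d (λ xs → fiberSum n (maxPrefixSum xs) (λ x → w (x ∷ xs)))
  latticeSum-suc n d w = begin
    sum (map F (concatMap (λ x → map (x ∷_) B) R))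
      ≡⟨ sum-map-concatMap F (λ x → map (x ∷_) B) R ⟩
    sum (map (λ x → sum (map F (map (x ∷_) B))) R)
      ≡⟨ sum-map-cong (λ x → trans (cong sum (sym (map-∘ B))) (sum-map-cong (F-∷ x) B)) R ⟩
    sum (map (λ x → sum (map (λ xs → 𝟙 (inDilatedSt n xs) * G x xs) B)) R)
      ≡⟨ sum-map-swap (λ x xs → 𝟙 (inDilatedSt n xs) * G x xs) R B ⟩
    sum (map (λ xs → sum (map (λ x → 𝟙 (inDilatedSt n xs) * G x xs) R)) B)
      ≡⟨ sum-map-cong (λ xs → sum-map-*ˡ (𝟙 (inDilatedSt n xs)) (λ x → G x xs) R) B ⟩
    latticeSum n d (λ xs → fiberSum n (maxPrefixSum xs) (λ x → w (x ∷ xs)))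
      ∎
    where
    R : List ℤ
    R = intRange n
    B : List (Vec ℤ d)
    B = box n d
    F : Vec ℤ (suc d) → ℕ
    F ys = 𝟙 (inDilatedSt n ys) * w ys
    G : ℤ → Vec ℤ d → ℕ
    G x xs = 𝟙 (headOK n (maxPrefixSum xs) x) * w (x ∷ xs)
    F-∷ : ∀ x xs → F (x ∷ xs) ≡ 𝟙 (inDilatedSt n xs) * G x xs
    F-∷ x xs = begin
      𝟙 (inDilatedSt n (x ∷ xs)) * w (x ∷ xs)
        ≡⟨ cong (λ b → 𝟙 b * w (x ∷ xs)) (inDilatedSt-∷ n x xs) ⟩
      𝟙 (headOK n (maxPrefixSum xs) x ∧ inDilatedSt n xs) * w (x ∷ xs)
        ≡⟨ cong (_* w (x ∷ xs)) (𝟙-∧ (headOK n (maxPrefixSum xs) x) (inDilatedSt n xs)) ⟩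
      𝟙 (headOK n (maxPrefixSum xs) x) * 𝟙 (inDilatedSt n xs) * w (x ∷ xs)
        ≡⟨ xy∙z≈y∙xz (𝟙 (headOK n (maxPrefixSum xs) x)) (𝟙 (inDilatedSt n xs)) (w (x ∷ xs)) ⟩
      𝟙 (inDilatedSt n xs) * G x xs
        ∎

  EhrhartSt-suc : ∀ n d → EhrhartSt (suc d) n + latticeSum n d maxPrefixSum ≡ suc (n + n) * EhrhartSt d n
  EhrhartSt-suc n d = begin
    EhrhartSt (suc d) n + latticeSum n d maxPrefixSum
      ≡⟨ cong (_+ latticeSum n d maxPrefixSum)
              (trans (EhrhartSt≡latticeSum (suc d) n) (latticeSum-suc n d (λ _ → 1))) ⟩
    latticeSum n d count + latticeSum n d maxPrefixSum
      ≡⟨ latticeSum-+ n d count maxPrefixSum ⟨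
    latticeSum n d (λ xs → count xs + maxPrefixSum xs)
      ≡⟨ latticeSum-cong n d (λ xs valid →
           trans (fiberSum-count n (maxPrefixSum-≤ n xs valid)) (sym (*-identityʳ K))) ⟩
    latticeSum n d (λ _ → K * 1)
      ≡⟨ latticeSum-*ˡ n d K (λ _ → 1) ⟩
    K * latticeSum n d (λ _ → 1)
      ≡⟨ cong (K *_) (EhrhartSt≡latticeSum d n) ⟨
    K * EhrhartSt d n
      ∎
    where
    K : ℕ
    K = suc (n + n)
    count : Vec ℤ d → ℕ
    count xs = fiberSum n (maxPrefixSum xs) (λ _ → 1)

  latticeSum-maxPrefixSum-suc : ∀ n d → 2 * latticeSum n (suc d) maxPrefixSum ≡ n * suc n * EhrhartSt d n
  latticeSum-maxPrefixSum-suc n d = begin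
    2 * latticeSum n (suc d) maxPrefixSum
      ≡⟨ cong (2 *_) (latticeSum-suc n d maxPrefixSum) ⟩
    2 * latticeSum n d weight
      ≡⟨ latticeSum-*ˡ n d 2 weight ⟨
    latticeSum n d (λ xs → 2 * weight xs)
      ≡⟨ latticeSum-cong n d (λ xs valid →
           trans (fiberSum-posPart n (maxPrefixSum-≤ n xs valid)) (sym (*-identityʳ (n * suc n)))) ⟩
    latticeSum n d (λ _ → n * suc n * 1)
      ≡⟨ latticeSum-*ˡ n d (n * suc n) (λ _ → 1) ⟩
    n * suc n * latticeSum n d (λ _ → 1)
      ≡⟨ cong (n * suc n *_) (EhrhartSt≡latticeSum d n) ⟨
    n * suc n * EhrhartSt d n
      ∎
    where
    weight : Vec ℤ d → ℕ
    weight xs = fiberSum n (maxPrefixSum xs) (λ x → posPart (x ℤ.+ + maxPrefixSum xs))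

  EhrhartSt-recurrence : ∀ n d →
    2 * EhrhartSt (suc (suc d)) n + n * (n + 1) * EhrhartSt d n ≡ 2 * (2 * n + 1) * EhrhartSt (suc d) n
  EhrhartSt-recurrence n d = begin
    2 * E₂ + n * (n + 1) * E₀  ≡⟨ cong (λ k → 2 * E₂ + n * k * E₀) (+-comm n 1) ⟩
    2 * E₂ + n * suc n * E₀    ≡⟨ cong (λ t → 2 * E₂ + t) (latticeSum-maxPrefixSum-suc n d) ⟨
    2 * E₂ + 2 * S₁            ≡⟨ *-distribˡ-+ 2 E₂ S₁ ⟨
    2 * (E₂ + S₁)              ≡⟨ cong (2 *_) (EhrhartSt-suc n (suc d)) ⟩
    2 * (suc (n + n) * E₁)     ≡⟨ regroup n E₁ ⟩
    2 * (2 * n + 1) * E₁       ∎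
    where
    E₀ E₁ E₂ S₁ : ℕ
    E₀ = EhrhartSt d n
    E₁ = EhrhartSt (suc d) n
    E₂ = EhrhartSt (suc (suc d)) n
    S₁ = latticeSum n (suc d) maxPrefixSum
    regroup : ∀ n e → 2 * (suc (n + n) * e) ≡ 2 * (2 * n + 1) * e
    regroup = solve-∀

open LatticeSums using (EhrhartSt-recurrence)
open import Data.Nat.Properties using (m≤n+m; m+n∸n≡m)
open import Data.Integer using (+_; _+_; _-_; _*_; _⊖_)
open import Data.Integer.Properties using (pos-+; pos-*; [+m]-[+n]≡m⊖n; ⊖-≥)

+m≡+o-+n : ∀ {m n o} → m ℕ.+ n ≡ o → + m ≡ + o - + n
+m≡+o-+n {m} {n} refl = begin
  + m                  ≡⟨ cong +_ (m+n∸n≡m m n) ⟨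
  + (m ℕ.+ n ℕ.∸ n)    ≡⟨ ⊖-≥ (m≤n+m n m) ⟨
  (m ℕ.+ n) ⊖ n        ≡⟨ [+m]-[+n]≡m⊖n (m ℕ.+ n) n ⟨
  + (m ℕ.+ n) - + n    ∎

pos-[m*[n+o]*p] : ∀ m n o p → + (m ℕ.* (n ℕ.+ o) ℕ.* p) ≡ + m * (+ n + + o) * + p
pos-[m*[n+o]*p] m n o p = begin
  + (m ℕ.* (n ℕ.+ o) ℕ.* p)   ≡⟨ pos-* (m ℕ.* (n ℕ.+ o)) p ⟩
  + (m ℕ.* (n ℕ.+ o)) * + p   ≡⟨ cong (_* + p) (pos-* m (n ℕ.+ o)) ⟩
  + m * + (n ℕ.+ o) * + p     ≡⟨ cong (λ k → + m * k * + p) (pos-+ n o) ⟩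
  + m * (+ n + + o) * + p     ∎

theorem3p1 : (e m : ℕ) →
    let d = suc (suc e) in
    let n = suc m in
    + 2 * + EhrhartSt d n
      ≡ + 2 * (+ (2 Data.Nat.* n) + + 1) * + EhrhartSt (suc e) n
        - + n * (+ n + + 1) * + EhrhartSt e n
theorem3p1 e m = begin
  + 2 * + E₂
    ≡⟨ pos-* 2 E₂ ⟨
  + (2 ℕ.* E₂)
    ≡⟨ +m≡+o-+n (EhrhartSt-recurrence n e) ⟩
  + (2 ℕ.* (2 ℕ.* n ℕ.+ 1) ℕ.* E₁) - + (n ℕ.* (n ℕ.+ 1) ℕ.* E₀)
    ≡⟨ cong₂ _-_ (pos-[m*[n+o]*p] 2 (2 ℕ.* n) 1 E₁) (pos-[m*[n+o]*p] n n 1 E₀) ⟩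
  + 2 * (+ (2 ℕ.* n) + + 1) * + E₁ - + n * (+ n + + 1) * + E₀
    ∎
  where
  n E₀ E₁ E₂ : ℕ
  n  = suc m
  E₀ = EhrhartSt e n
  E₁ = EhrhartSt (suc e) n
  E₂ = EhrhartSt (suc (suc e)) n
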